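{- For every integer $n\ge1$, $$\left\lfloor\left(\sum_{k=n}^\infty\frac{(-1)^k}{B_k^2}\right)^{ -1}\right\rfloor=\begin{cases}B_n^2+B_{n-1}^2&\text{if $n$ is even},\\ -(B_n^2+B_{n-1}^2+1)&\text{if $n$ is odd}.\end{cases}$$
   Context: The balancing numbers are defined by $B_0=0$, $B_1=1$, $B_n=6B_{n-1}-B_{n-2}$ for $n\ge 2$. $\lfloor x\rfloor$ denotes the floor of a real number $x$. -}

module Defs where

open import Data.Nat as ℕ using (ℕ; zero; suc; _≥_)
open import Data.Integer as ℤ using (ℤ; +_; -[1+_])
open import Data.Rational using (ℚ; mkℚ; _/_; 0ℚ; 1ℚ; 1/_; _+_; _-_; _*_; -_; ∣_∣; _<_; _≤_; Positive)
open import Data.Product using (Σ; _×_; ∃)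

B : ℕ → ℤ
B zero = + 0
B (suc zero) = + 1
B (suc (suc n)) = (+ 6) ℤ.* B (suc n) ℤ.- B n

toℚ : ℤ → ℚ
toℚ z = z / 1

-- total inverse on ℚ (inv 0 = 0); only ever applied to nonzero values
-- in the relevant (eventual) range
inv : ℚ → ℚ
inv p@(mkℚ (+ zero) _ _) = 0ℚ
inv p@(mkℚ (+ (suc _)) _ _) = 1/ p
inv p@(mkℚ -[1+ _ ] _ _) = 1/ p

alt : ℕ → ℚ
alt zero = 1ℚ
alt (suc k) = - alt k

term : ℕ → ℚ
term k = alt k * inv (toℚ (B k ℤ.* B k))

tailPartial : ℕ → ℕ → ℚ
tailPartial n zero = term n
tailPartial n (suc N) = tailPartial n N + term (n ℕ.+ suc N)

Cauchy : (ℕ → ℚ) → Set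
Cauchy s = ∀ (ε : ℚ) → Positive ε →
  ∃ λ N → ∀ i j → i ≥ N → j ≥ N → ∣ s i - s j ∣ < ε

-- The sequence s converges to a real number L ≠ 0 with ⌊ 1 / L ⌋ = f.
-- Encoded via rationals: s is Cauchy (so has a real limit L), s is eventually
-- bounded away from 0 (so L ≠ 0, and 1/s_k → 1/L), and
--   f ≤ 1/L     ⇔ ∀ ε>0, eventually f - ε < 1/s_k
--   1/L < f + 1 ⇔ ∃ ε>0, eventually 1/s_k ≤ f + 1 - ε
LimitInvFloor : (ℕ → ℚ) → ℤ → Set
LimitInvFloor s f =
  Cauchy s ×
  (∃ λ δ → Positive δ × ∃ λ N → ∀ k → k ≥ N → δ ≤ ∣ s k ∣) ×
  (∀ (ε : ℚ) → Positive ε → ∃ λ N → ∀ k → k ≥ N → toℚ f - ε < inv (s k)) ×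
  (∃ λ ε → Positive ε × ∃ λ N → ∀ k → k ≥ N → inv (s k) ≤ toℚ f + 1ℚ - ε)

{-# OPTIONS --safe #-}
-- Let S_n be the tail Σ_{k ≥ n} (-1)^k / B_k² and c_n = B_n² + B_{n-1}².
-- Consecutive balancing numbers satisfy B_n² − 6 B_n B_{n-1} + B_{n-1}² = 1,
-- and from this one checks, with upper_n = 1/(c_n + 1/100) and
-- lower_n = 1/(c_n + 1/2),
--   1/B_n² ≤ upper_n + lower_{n+1}   and   lower_n + upper_{n+1} ≤ 1/B_n².
-- Since |S_n| = 1/B_n² − |S_{n+1}|, these interleaved inequalities propagate
-- lower_n ≤ |S_n| ≤ upper_n, i.e. c_n + 1/100 ≤ 1/|S_n| ≤ c_n + 1/2, while
-- the sign of S_n is (-1)^n; so the floor is c_n for even n and −c_n − 1 for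
-- odd n. On partial sums the same bounds hold up to the last term, which tends
-- to 0.

module Submission where

open import Defs
open import Data.Nat as ℕ using (ℕ; zero; suc; _∸_; _≥_)
import Data.Nat.Properties as ℕP
open import Data.Nat.Divisibility using (_∣_; divides; ∣m∣n⇒∣m+n; ∣m+n∣m⇒∣n; ∣-refl; ∣1⇒≡1)
import Data.Nat.Coprimality as Coprimality
open import Data.Integer as ℤ using (ℤ; +_; -[1+_]; +[1+_]; +≤+; +<+)
import Data.Integer.Properties as ℤP
open import Data.Integer.Tactic.RingSolver using (solve-∀)
open import Data.Rational as ℚ using (ℚ; mkℚ; 0ℚ; 1ℚ; _+_; _-_; _*_; -_; ∣_∣; _<_; _≤_; Positive; *≤*; *<*)
import Data.Rational.Properties as ℚP
open import Data.Rational.Solver using (module +-*-Solver)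
open +-*-Solver
open import Relation.Binary.PropositionalEquality
open import Relation.Binary using (tri<; tri≈; tri>)
open import Data.Product using (_×_; _,_; proj₁; proj₂; ∃)
open import Data.Sum using (_⊎_; inj₁; inj₂)
open import Data.Empty using (⊥-elim)
open import Relation.Nullary using (¬_)

0≤+ : ∀ n → + 0 ℤ.≤ + n
0≤+ n = +≤+ ℕ.z≤n

0<+suc : ∀ {n} → + 0 ℤ.< + suc n
0<+suc = +<+ (ℕ.s≤s ℕ.z≤n)

+-nonNeg : ∀ {i j} → + 0 ℤ.≤ i → + 0 ℤ.≤ j → + 0 ℤ.≤ i ℤ.+ j
+-nonNeg = ℤP.+-mono-≤

*-nonNeg : ∀ {i j} → + 0 ℤ.≤ i → + 0 ℤ.≤ j → + 0 ℤ.≤ i ℤ.* j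
*-nonNeg {+ m} {+ n} _ _ = subst (+ 0 ℤ.≤_) (ℤP.pos-* m n) (0≤+ (m ℕ.* n))

*-pos : ∀ {i j} → + 0 ℤ.< i → + 0 ℤ.< j → + 0 ℤ.< i ℤ.* j
*-pos {+[1+ m ]} {+[1+ n ]} _ _ = 0<+suc
*-pos {+ zero} (+<+ ()) _
*-pos {+[1+ m ]} {+ zero} _ (+<+ ())

+suc-pos : ∀ {i} n → + 0 ℤ.≤ i → + 0 ℤ.< i ℤ.+ + suc n
+suc-pos n 0≤i = ℤP.+-mono-≤-< 0≤i 0<+suc

*+suc-pos : ∀ m n {i} → + 0 ℤ.≤ i → + 0 ℤ.< + m ℤ.* i ℤ.+ + suc n
*+suc-pos m n 0≤i = +suc-pos n (*-nonNeg (0≤+ m) 0≤i)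

square-mono : ∀ {i j} → + 0 ℤ.≤ i → i ℤ.≤ j → i ℤ.* i ℤ.≤ j ℤ.* j
square-mono {i} {j} 0≤i i≤j = ℤP.≤-trans
  (ℤP.*-monoˡ-≤-nonNeg i {{ℤ.nonNegative 0≤i}} i≤j)
  (ℤP.*-monoʳ-≤-nonNeg j {{ℤ.nonNegative (ℤP.≤-trans 0≤i i≤j)}} i≤j)

≤-by-difference : ∀ i j d → j ℤ.- i ≡ d → + 0 ℤ.≤ d → i ℤ.≤ j
≤-by-difference i j d j-i≡d 0≤d = ℤP.0≤i-j⇒j≤i (subst (+ 0 ℤ.≤_) (sym j-i≡d) 0≤d)

≤-by-certificate : ∀ i j q r d → j ℤ.- i ≡ q ℤ.* r ℤ.+ d → r ≡ + 0 → + 0 ℤ.≤ d → i ℤ.≤ j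
≤-by-certificate i j q r d j-i≡qr+d r≡0 = ≤-by-difference i j d (begin
  j ℤ.- i          ≡⟨ j-i≡qr+d ⟩
  q ℤ.* r ℤ.+ d    ≡⟨ cong (λ x → q ℤ.* x ℤ.+ d) r≡0 ⟩
  q ℤ.* + 0 ℤ.+ d  ≡⟨ cong (ℤ._+ d) (ℤP.*-zeroʳ q) ⟩
  + 0 ℤ.+ d        ≡⟨ ℤP.+-identityˡ d ⟩
  d                ∎)
  where open ≡-Reasoning

B-cassini : ∀ k → B (suc k) ℤ.* B (suc k) ℤ.- + 6 ℤ.* B (suc k) ℤ.* B k ℤ.+ B k ℤ.* B k ≡ + 1
B-cassini zero = refl
B-cassini (suc k) = trans (invariant (B (suc k)) (B k)) (B-cassini k)
  where
  invariant : ∀ x y → (+ 6 ℤ.* x ℤ.- y) ℤ.* (+ 6 ℤ.* x ℤ.- y) ℤ.- + 6 ℤ.* (+ 6 ℤ.* x ℤ.- y) ℤ.* x ℤ.+ x ℤ.* x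
                    ≡ x ℤ.* x ℤ.- + 6 ℤ.* x ℤ.* y ℤ.+ y ℤ.* y
  invariant = solve-∀

B-nonNeg×increasing : ∀ k → + 0 ℤ.≤ B k × B k ℤ.+ + 1 ℤ.≤ B (suc k)
B-nonNeg×increasing zero = 0≤+ 0 , ℤP.≤-refl
B-nonNeg×increasing (suc k) with B-nonNeg×increasing k
... | 0≤y , y<x = 0≤x , ≤-by-difference (x ℤ.+ + 1) (B (suc (suc k))) _ (gap x y)
                          (+-nonNeg (*-nonNeg (0≤+ 4) 0≤x) (ℤP.i≤j⇒0≤j-i y<x))
  where
  x = B (suc k)
  y = B k
  0≤x : + 0 ℤ.≤ x
  0≤x = ℤP.≤-trans 0≤y (ℤP.≤-trans (ℤP.i≤i+j y (+ 1)) y<x)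
  gap : ∀ x y → (+ 6 ℤ.* x ℤ.- y) ℤ.- (x ℤ.+ + 1) ≡ + 4 ℤ.* x ℤ.+ (x ℤ.- (y ℤ.+ + 1))
  gap = solve-∀

B-nonNeg : ∀ k → + 0 ℤ.≤ B k
B-nonNeg k = proj₁ (B-nonNeg×increasing k)

B-increasing : ∀ k → B k ℤ.+ + 1 ℤ.≤ B (suc k)
B-increasing k = proj₂ (B-nonNeg×increasing k)

B-≤-suc : ∀ k → B k ℤ.≤ B (suc k)
B-≤-suc k = ℤP.≤-trans (ℤP.i≤i+j (B k) (+ 1)) (B-increasing k)

B-≥ : ∀ k → + suc k ℤ.≤ B (suc k)
B-≥ zero = ℤP.≤-refl
B-≥ (suc k) = ℤP.≤-trans (ℤP.+-monoʳ-≤ (+ 1) (B-≥ k))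
                (subst (ℤ._≤ B (suc (suc k))) (ℤP.+-comm (B (suc k)) (+ 1)) (B-increasing (suc k)))

B-pos : ∀ k → + 0 ℤ.< B (suc k)
B-pos k = ℤP.<-≤-trans 0<+suc (B-≥ k)

B²-pos : ∀ k → + 0 ℤ.< B (suc k) ℤ.* B (suc k)
B²-pos k = *-pos (B-pos k) (B-pos k)

B-5× : ∀ k → + 5 ℤ.* B k ℤ.≤ B (suc k)
B-5× zero = 0≤+ 1
B-5× (suc k) = ≤-by-difference _ _ (B (suc k) ℤ.- B k) (gap (B (suc k)) (B k)) (ℤP.i≤j⇒0≤j-i (B-≤-suc k))
  where
  gap : ∀ x y → (+ 6 ℤ.* x ℤ.- y) ℤ.- + 5 ℤ.* x ≡ x ℤ.- y
  gap = solve-∀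

B²-≥ : ∀ k → + suc k ℤ.≤ B (suc k) ℤ.* B (suc k)
B²-≥ k = ℤP.≤-trans (B-≥ k) (ℤP.≤-trans (ℤP.≤-reflexive (sym (ℤP.*-identityʳ x)))
           (ℤP.*-monoˡ-≤-nonNeg x {{ℤ.nonNegative (B-nonNeg (suc k))}} (ℤP.≤-trans (+≤+ (ℕ.s≤s ℕ.z≤n)) (B-≥ k))))
  where x = B (suc k)

inv-inverseʳ : ∀ p → 0ℚ < p → p * inv p ≡ 1ℚ
inv-inverseʳ p@(mkℚ +[1+ n ] d c) _ = ℚP.*-inverseʳ p
inv-inverseʳ (mkℚ (+ zero) d c) (*<* (+<+ ()))
inv-inverseʳ (mkℚ -[1+ n ] d c) (*<* ())

inv-pos : ∀ p → 0ℚ < p → 0ℚ < inv p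
inv-pos (mkℚ +[1+ n ] d c) _ = ℚP.positive⁻¹ _
inv-pos (mkℚ (+ zero) d c) (*<* (+<+ ()))
inv-pos (mkℚ -[1+ n ] d c) (*<* ())

inv-neg : ∀ p → 0ℚ < p → inv (- p) ≡ - inv p
inv-neg (mkℚ +[1+ n ] d c) _ = refl
inv-neg (mkℚ (+ zero) d c) (*<* (+<+ ()))
inv-neg (mkℚ -[1+ n ] d c) (*<* ())

inv-unique : ∀ p q → 0ℚ < p → p * q ≡ 1ℚ → inv p ≡ q
inv-unique p q 0<p pq≡1 = begin
  inv p              ≡⟨ sym (ℚP.*-identityʳ (inv p)) ⟩
  inv p * 1ℚ         ≡⟨ cong (inv p *_) (sym pq≡1) ⟩
  inv p * (p * q)    ≡⟨ sym (ℚP.*-assoc (inv p) p q) ⟩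
  (inv p * p) * q    ≡⟨ cong (_* q) (trans (ℚP.*-comm (inv p) p) (inv-inverseʳ p 0<p)) ⟩
  1ℚ * q             ≡⟨ ℚP.*-identityˡ q ⟩
  q                  ∎
  where open ≡-Reasoning

pos⇒nonNeg : ∀ {p} → 0ℚ < p → ℚ.NonNegative p
pos⇒nonNeg 0<p = ℚ.nonNegative (ℚP.<⇒≤ 0<p)

*-pos-ℚ : ∀ {p q} → 0ℚ < p → 0ℚ < q → 0ℚ < p * q
*-pos-ℚ {p} {q} 0<p 0<q = ℚP.positive⁻¹ (p * q) {{ℚP.pos*pos⇒pos p {{ℚ.positive 0<p}} q {{ℚ.positive 0<q}}}}

inv-antimono-≤ : ∀ p q → 0ℚ < p → p ≤ q → inv q ≤ inv p
inv-antimono-≤ p q 0<p p≤q = begin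
  inv q                   ≡⟨ sym (ℚP.*-identityʳ (inv q)) ⟩
  inv q * 1ℚ              ≡⟨ cong (inv q *_) (sym (inv-inverseʳ p 0<p)) ⟩
  inv q * (p * inv p)     ≡⟨ sym (ℚP.*-assoc (inv q) p (inv p)) ⟩
  (inv q * p) * inv p     ≤⟨ ℚP.*-monoʳ-≤-nonNeg (inv p) {{pos⇒nonNeg (inv-pos p 0<p)}}
                               (ℚP.*-monoˡ-≤-nonNeg (inv q) {{pos⇒nonNeg (inv-pos q 0<q)}} p≤q) ⟩
  (inv q * q) * inv p     ≡⟨ cong (_* inv p) (trans (ℚP.*-comm (inv q) q) (inv-inverseʳ q 0<q)) ⟩
  1ℚ * inv p              ≡⟨ ℚP.*-identityˡ (inv p) ⟩
  inv p                   ∎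
  where
  open ℚP.≤-Reasoning
  0<q = ℚP.<-≤-trans 0<p p≤q

toℚ≡mkℚ : ∀ a → toℚ a ≡ mkℚ a 0 (Coprimality.sym (Coprimality.1-coprimeTo ℤ.∣ a ∣))
toℚ≡mkℚ a = ℚP.↥p/↧p≡p (mkℚ a 0 (Coprimality.sym (Coprimality.1-coprimeTo ℤ.∣ a ∣)))

toℚ-+ : ∀ a b → toℚ (a ℤ.+ b) ≡ toℚ a + toℚ b
toℚ-+ a b = trans (cong (ℚ._/ 1) (cong₂ ℤ._+_ (sym (ℤP.*-identityʳ a)) (sym (ℤP.*-identityʳ b))))
                  (sym (cong₂ _+_ (toℚ≡mkℚ a) (toℚ≡mkℚ b)))

toℚ-* : ∀ a b → toℚ (a ℤ.* b) ≡ toℚ a * toℚ b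
toℚ-* a b = sym (cong₂ _*_ (toℚ≡mkℚ a) (toℚ≡mkℚ b))

toℚ-neg : ∀ a → toℚ (ℤ.- a) ≡ - toℚ a
toℚ-neg a = trans (toℚ≡mkℚ (ℤ.- a)) (sym (trans (cong -_ (toℚ≡mkℚ a)) (mkℚ-neg a)))
  where
  mkℚ-neg : ∀ a → - mkℚ a 0 (Coprimality.sym (Coprimality.1-coprimeTo ℤ.∣ a ∣))
                ≡ mkℚ (ℤ.- a) 0 (Coprimality.sym (Coprimality.1-coprimeTo ℤ.∣ ℤ.- a ∣))
  mkℚ-neg (+ zero) = refl
  mkℚ-neg +[1+ n ] = refl
  mkℚ-neg -[1+ n ] = refl

toℚ-mono-≤ : ∀ {a b} → a ℤ.≤ b → toℚ a ≤ toℚ b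
toℚ-mono-≤ {a} {b} a≤b rewrite toℚ≡mkℚ a | toℚ≡mkℚ b =
  *≤* (subst₂ ℤ._≤_ (sym (ℤP.*-identityʳ a)) (sym (ℤP.*-identityʳ b)) a≤b)

toℚ-mono-< : ∀ {a b} → a ℤ.< b → toℚ a < toℚ b
toℚ-mono-< {a} {b} a<b rewrite toℚ≡mkℚ a | toℚ≡mkℚ b =
  *<* (subst₂ ℤ._<_ (sym (ℤP.*-identityʳ a)) (sym (ℤP.*-identityʳ b)) a<b)

infixl 7 _⁄_

_⁄_ : ℤ → ℤ → ℚ
a ⁄ b = toℚ a * inv (toℚ b)

1⁄b≡inv : ∀ b → + 1 ⁄ b ≡ inv (toℚ b)
1⁄b≡inv b = ℚP.*-identityˡ (inv (toℚ b))

toℚ-+-⁄ : ∀ a c {b} → + 0 ℤ.< b → toℚ a + c ⁄ b ≡ (a ℤ.* b ℤ.+ c) ⁄ b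
toℚ-+-⁄ a c {b} 0<b = sym (begin
  toℚ (a ℤ.* b ℤ.+ c) * iB          ≡⟨ cong (_* iB) (trans (toℚ-+ (a ℤ.* b) c) (cong (_+ toℚ c) (toℚ-* a b))) ⟩
  (toℚ a * toℚ b + toℚ c) * iB      ≡⟨ solve 4 (λ A B C U → (A :* B :+ C) :* U := A :* (B :* U) :+ C :* U) refl (toℚ a) (toℚ b) (toℚ c) iB ⟩
  toℚ a * (toℚ b * iB) + c ⁄ b       ≡⟨ cong (λ x → toℚ a * x + c ⁄ b) (inv-inverseʳ _ (toℚ-mono-< 0<b)) ⟩
  toℚ a * 1ℚ + c ⁄ b                 ≡⟨ cong (_+ c ⁄ b) (ℚP.*-identityʳ (toℚ a)) ⟩
  toℚ a + c ⁄ b                      ∎)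
  where
  open ≡-Reasoning
  iB = inv (toℚ b)

module _ {b d : ℤ} (0<b : + 0 ℤ.< b) (0<d : + 0 ℤ.< d) where

  private
    iB iD : ℚ
    iB = inv (toℚ b)
    iD = inv (toℚ d)

    b*iB≡1 : toℚ b * iB ≡ 1ℚ
    b*iB≡1 = inv-inverseʳ (toℚ b) (toℚ-mono-< 0<b)

    d*iD≡1 : toℚ d * iD ≡ 1ℚ
    d*iD≡1 = inv-inverseʳ (toℚ d) (toℚ-mono-< 0<d)

  inv-toℚ-* : inv (toℚ (b ℤ.* d)) ≡ iB * iD
  inv-toℚ-* = inv-unique (toℚ (b ℤ.* d)) (iB * iD) (toℚ-mono-< (*-pos 0<b 0<d)) (begin
    toℚ (b ℤ.* d) * (iB * iD)    ≡⟨ cong (_* (iB * iD)) (toℚ-* b d) ⟩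
    (toℚ b * toℚ d) * (iB * iD)  ≡⟨ solve 4 (λ x y z w → (x :* y) :* (z :* w) := (x :* z) :* (y :* w)) refl (toℚ b) (toℚ d) iB iD ⟩
    (toℚ b * iB) * (toℚ d * iD)  ≡⟨ cong₂ _*_ b*iB≡1 d*iD≡1 ⟩
    1ℚ                           ∎)
    where open ≡-Reasoning

  ⁄-pos : 0ℚ < b ⁄ d
  ⁄-pos = *-pos-ℚ (toℚ-mono-< 0<b) (inv-pos _ (toℚ-mono-< 0<d))

  inv-⁄ : inv (b ⁄ d) ≡ d ⁄ b
  inv-⁄ = inv-unique (b ⁄ d) (d ⁄ b) ⁄-pos (begin
    toℚ b * iD * (toℚ d * iB)    ≡⟨ solve 4 (λ B U D V → B :* V :* (D :* U) := (B :* U) :* (D :* V)) refl (toℚ b) iB (toℚ d) iD ⟩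
    (toℚ b * iB) * (toℚ d * iD)  ≡⟨ cong₂ _*_ b*iB≡1 d*iD≡1 ⟩
    1ℚ                           ∎)
    where open ≡-Reasoning

  ⁄-*-cancelʳ : ∀ a → a ⁄ b ≡ (a ℤ.* d) ⁄ (b ℤ.* d)
  ⁄-*-cancelʳ a = sym (begin
    toℚ (a ℤ.* d) * inv (toℚ (b ℤ.* d))  ≡⟨ cong₂ _*_ (toℚ-* a d) inv-toℚ-* ⟩
    toℚ a * toℚ d * (iB * iD)            ≡⟨ solve 4 (λ A D U V → A :* D :* (U :* V) := A :* U :* (D :* V)) refl (toℚ a) (toℚ d) iB iD ⟩
    toℚ a * iB * (toℚ d * iD)            ≡⟨ cong (toℚ a * iB *_) d*iD≡1 ⟩
    toℚ a * iB * 1ℚ                      ≡⟨ ℚP.*-identityʳ _ ⟩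
    a ⁄ b                                ∎)
    where open ≡-Reasoning

  ⁄-+ : ∀ a c → a ⁄ b + c ⁄ d ≡ (a ℤ.* d ℤ.+ c ℤ.* b) ⁄ (b ℤ.* d)
  ⁄-+ a c = sym (begin
    toℚ (a ℤ.* d ℤ.+ c ℤ.* b) * inv (toℚ (b ℤ.* d))
      ≡⟨ cong₂ _*_ (trans (toℚ-+ (a ℤ.* d) (c ℤ.* b)) (cong₂ _+_ (toℚ-* a d) (toℚ-* c b))) inv-toℚ-* ⟩
    (A * toℚ d + C * toℚ b) * (iB * iD)
      ≡⟨ solve 6 (λ A B C D U V → (A :* D :+ C :* B) :* (U :* V) := A :* U :* (D :* V) :+ C :* V :* (B :* U))
               refl A (toℚ b) C (toℚ d) iB iD ⟩
    A * iB * (toℚ d * iD) + C * iD * (toℚ b * iB)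
      ≡⟨ cong₂ _+_ (cong (A * iB *_) d*iD≡1) (cong (C * iD *_) b*iB≡1) ⟩
    A * iB * 1ℚ + C * iD * 1ℚ
      ≡⟨ cong₂ _+_ (ℚP.*-identityʳ (A * iB)) (ℚP.*-identityʳ (C * iD)) ⟩
    a ⁄ b + c ⁄ d ∎)
    where
    open ≡-Reasoning
    A = toℚ a
    C = toℚ c

  ⁄-- : ∀ a c → a ⁄ b - c ⁄ d ≡ (a ℤ.* d ℤ.- c ℤ.* b) ⁄ (b ℤ.* d)
  ⁄-- a c = begin
    a ⁄ b - c ⁄ d                           ≡⟨ cong (λ x → a ⁄ b + x) (ℚP.neg-distribˡ-* (toℚ c) iD) ⟩
    a ⁄ b + (- toℚ c) * iD                  ≡⟨ cong (λ x → a ⁄ b + x * iD) (sym (toℚ-neg c)) ⟩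
    a ⁄ b + (ℤ.- c) ⁄ d                     ≡⟨ ⁄-+ a (ℤ.- c) ⟩
    (a ℤ.* d ℤ.+ ℤ.- c ℤ.* b) ⁄ (b ℤ.* d)  ≡⟨ cong (λ x → (a ℤ.* d ℤ.+ x) ⁄ (b ℤ.* d)) (sym (ℤP.neg-distribˡ-* c b)) ⟩
    (a ℤ.* d ℤ.- c ℤ.* b) ⁄ (b ℤ.* d)      ∎
    where open ≡-Reasoning

module _ {b d : ℤ} (0<b : + 0 ℤ.< b) (0<d : + 0 ℤ.< d) where

  ⁄-mono-≤ : ∀ a c → a ℤ.* d ℤ.≤ c ℤ.* b → a ⁄ b ≤ c ⁄ d
  ⁄-mono-≤ a c ad≤cb = begin
    a ⁄ b                  ≡⟨ ⁄-*-cancelʳ 0<b 0<d a ⟩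
    (a ℤ.* d) ⁄ (b ℤ.* d)  ≤⟨ ℚP.*-monoʳ-≤-nonNeg _ {{pos⇒nonNeg (inv-pos _ (toℚ-mono-< (*-pos 0<b 0<d)))}}
                              (toℚ-mono-≤ ad≤cb) ⟩
    (c ℤ.* b) ⁄ (b ℤ.* d)  ≡⟨ cong (λ x → (c ℤ.* b) ⁄ x) (ℤP.*-comm b d) ⟩
    (c ℤ.* b) ⁄ (d ℤ.* b)  ≡⟨ sym (⁄-*-cancelʳ 0<d 0<b c) ⟩
    c ⁄ d                  ∎
    where open ℚP.≤-Reasoning

0<1⁄4 : 0ℚ < + 1 ⁄ + 4
0<1⁄4 = ⁄-pos {+ 1} {+ 4} 0<+suc 0<+suc

0<1⁄200 : 0ℚ < + 1 ⁄ + 200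
0<1⁄200 = ⁄-pos {+ 1} {+ 200} 0<+suc 0<+suc

3⁄4≡1-1⁄4 : + 3 ⁄ + 4 ≡ 1ℚ - + 1 ⁄ + 4
3⁄4≡1-1⁄4 = refl

p≤q⇒0≤q-p : ∀ {p q} → p ≤ q → 0ℚ ≤ q - p
p≤q⇒0≤q-p {p} {q} p≤q = subst (_≤ q - p) (ℚP.+-inverseʳ p) (ℚP.+-monoˡ-≤ (- p) p≤q)

0≤p⇒q-p≤q : ∀ {p} q → 0ℚ ≤ p → q - p ≤ q
0≤p⇒q-p≤q {p} q 0≤p = subst (q - p ≤_) (ℚP.+-identityʳ q) (ℚP.+-monoʳ-≤ q (ℚP.neg-antimono-≤ 0≤p))

q≤p+q : ∀ q {p} → 0ℚ ≤ p → q ≤ p + q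
q≤p+q q {p} 0≤p = subst (_≤ p + q) (ℚP.+-identityˡ q) (ℚP.+-monoˡ-≤ q 0≤p)

∣p-q∣≡∣q-p∣ : ∀ p q → ∣ p - q ∣ ≡ ∣ q - p ∣
∣p-q∣≡∣q-p∣ p q = trans (cong ∣_∣ (solve 2 (λ p q → p :- q := :- (q :- p)) refl p q)) (ℚP.∣-p∣≡∣p∣ (q - p))

p-q<p : ∀ p q → Positive q → p - q < p
p-q<p p q q>0 = subst (p - q <_) (ℚP.+-identityʳ p) (ℚP.+-monoʳ-< p (ℚP.neg-antimono-< (ℚP.positive⁻¹ q {{q>0}})))

q≤q+p : ∀ q {p} → 0ℚ ≤ p → q ≤ q + p
q≤q+p q {p} 0≤p = subst (_≤ q + p) (ℚP.+-identityʳ q) (ℚP.+-monoʳ-≤ q 0≤p)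

alt-+ : ∀ m n → alt (m ℕ.+ n) ≡ alt m * alt n
alt-+ zero n = sym (ℚP.*-identityˡ (alt n))
alt-+ (suc m) n = trans (cong -_ (alt-+ m n)) (ℚP.neg-distribˡ-* (alt m) (alt n))

∣alt∣≡1 : ∀ k → ∣ alt k ∣ ≡ 1ℚ
∣alt∣≡1 zero = refl
∣alt∣≡1 (suc k) = trans (ℚP.∣-p∣≡∣p∣ (alt k)) (∣alt∣≡1 k)

altSum : (ℕ → ℚ) → ℕ → ℕ → ℚ
altSum f j zero = f j
altSum f j (suc m) = f j - altSum f (suc j) m

Vanishes : (ℕ → ℚ) → Set
Vanishes f = ∀ ε → Positive ε → ∃ λ N → f N < ε

module _ (f : ℕ → ℚ) where

  altSum-split : ∀ j i m → altSum f j (i ℕ.+ suc m) ≡ altSum f j i + alt (suc i) * altSum f (j ℕ.+ suc i) m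
  altSum-split j zero m rewrite ℕP.+-comm j 1 =
    solve 2 (λ x y → x :- y := x :+ (:- con 1ℚ) :* y) refl (f j) (altSum f (suc j) m)
  altSum-split j (suc i) m rewrite altSum-split (suc j) i m | ℕP.+-suc j (suc i) =
    solve 4 (λ x r s y → x :- (r :+ s :* y) := (x :- r) :+ (:- s) :* y) refl
      (f j) (altSum f (suc j) i) (alt (suc i)) (altSum f (suc (j ℕ.+ suc i)) m)

  altSum-snoc : ∀ j m → altSum f j (suc m) ≡ altSum f j m + alt (suc m) * f (j ℕ.+ suc m)
  altSum-snoc j m = trans (cong (altSum f j) (ℕP.+-comm 1 m)) (altSum-split j m 0)

module _ {f : ℕ → ℚ} (f-nonNeg : ∀ j → 0ℚ ≤ f j) (f-antitone : ∀ j → f (suc j) ≤ f j) where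

  antitone-+ : ∀ m o → f (m ℕ.+ o) ≤ f m
  antitone-+ m zero rewrite ℕP.+-identityʳ m = ℚP.≤-refl
  antitone-+ m (suc o) rewrite ℕP.+-suc m o = ℚP.≤-trans (f-antitone (m ℕ.+ o)) (antitone-+ m o)

  antitone : ∀ {m n} → m ℕ.≤ n → f n ≤ f m
  antitone {m} m≤n with ℕP.m≤n⇒∃[o]m+o≡n m≤n
  ... | o , refl = antitone-+ m o

  altSum-bounds : ∀ j m → 0ℚ ≤ altSum f j m × altSum f j m ≤ f j
  altSum-bounds j zero = f-nonNeg j , ℚP.≤-refl
  altSum-bounds j (suc m) with altSum-bounds (suc j) m
  ... | 0≤r , r≤f = p≤q⇒0≤q-p (ℚP.≤-trans r≤f (f-antitone j)) , 0≤p⇒q-p≤q (f j) 0≤r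

  ∣altSum-altSum∣≤ : ∀ j i m → ∣ altSum f j (i ℕ.+ suc m) - altSum f j i ∣ ≤ f (j ℕ.+ suc i)
  ∣altSum-altSum∣≤ j i m = begin
    ∣ altSum f j (i ℕ.+ suc m) - altSum f j i ∣ ≡⟨ cong (λ x → ∣ x - altSum f j i ∣) (altSum-split f j i m) ⟩
    ∣ altSum f j i + alt (suc i) * r - altSum f j i ∣
      ≡⟨ cong ∣_∣ (solve 3 (λ x s y → x :+ s :* y :- x := s :* y) refl (altSum f j i) (alt (suc i)) r) ⟩
    ∣ alt (suc i) * r ∣                         ≡⟨ ℚP.∣p*q∣≡∣p∣*∣q∣ (alt (suc i)) r ⟩
    ∣ alt (suc i) ∣ * ∣ r ∣                     ≡⟨ cong₂ _*_ (∣alt∣≡1 (suc i)) (ℚP.0≤p⇒∣p∣≡p (proj₁ (altSum-bounds _ m))) ⟩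
    1ℚ * r                                      ≡⟨ ℚP.*-identityˡ r ⟩
    r                                           ≤⟨ proj₂ (altSum-bounds _ m) ⟩
    f (j ℕ.+ suc i)                             ∎
    where
    open ℚP.≤-Reasoning
    r = altSum f (j ℕ.+ suc i) m

  module _ (f-vanishes : Vanishes f) where

    eventually-< : ∀ ε → Positive ε → ∃ λ N → ∀ n → N ℕ.≤ n → f n < ε
    eventually-< ε ε>0 with f-vanishes ε ε>0
    ... | N , fN<ε = N , λ n N≤n → ℚP.≤-<-trans (antitone N≤n) fN<ε

    altSum-cauchy : ∀ j → Cauchy (altSum f j)
    altSum-cauchy j ε ε>0 with eventually-< ε ε>0
    ... | N , small = N , close
      where
      R = altSum f j
      later : ∀ i m → N ℕ.≤ i → ∣ R (suc (i ℕ.+ m)) - R i ∣ < ε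
      later i m N≤i = subst (λ n → ∣ R n - R i ∣ < ε) (ℕP.+-suc i m)
        (ℚP.≤-<-trans (∣altSum-altSum∣≤ j i m)
          (small (j ℕ.+ suc i) (ℕP.≤-trans N≤i (ℕP.≤-trans (ℕP.n≤1+n i) (ℕP.m≤n+m (suc i) j)))))
      close : ∀ i i′ → i ≥ N → i′ ≥ N → ∣ R i - R i′ ∣ < ε
      close i i′ N≤i N≤i′ with ℕP.<-cmp i i′
      ... | tri≈ _ refl _ = subst (_< ε) (sym (cong ∣_∣ (ℚP.+-inverseʳ (R i)))) (ℚP.positive⁻¹ ε {{ε>0}})
      ... | tri< i<i′ _ _ with ℕP.m≤n⇒∃[o]m+o≡n i<i′
      ...   | m , refl = subst (_< ε) (∣p-q∣≡∣q-p∣ (R (suc (i ℕ.+ m))) (R i)) (later i m N≤i)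
      close i i′ N≤i N≤i′ | tri> _ _ i′<i with ℕP.m≤n⇒∃[o]m+o≡n i′<i
      ...   | m , refl = later i′ m N≤i′

module _ {f U W : ℕ → ℚ} (f-nonNeg : ∀ j → 0ℚ ≤ f j) (U-nonNeg : ∀ j → 0ℚ ≤ U j)
         (f≤U+W : ∀ j → f j ≤ U j + W (suc j)) (W+U≤f : ∀ j → W j + U (suc j) ≤ f j) where

  altSum-envelope : ∀ j m → W j - f (j ℕ.+ m) ≤ altSum f j m × altSum f j m ≤ U j + f (j ℕ.+ m)
  altSum-envelope j zero rewrite ℕP.+-identityʳ j =
    ℚP.≤-trans (0≤p⇒q-p≤q (W j) (f-nonNeg j)) (ℚP.≤-trans (q≤q+p (W j) (U-nonNeg (suc j))) (W+U≤f j)) ,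
    q≤p+q (f j) (U-nonNeg j)
  altSum-envelope j (suc m) rewrite ℕP.+-suc j m with altSum-envelope (suc j) m
  ... | W-E≤r , r≤U+E = lower , upper
    where
    r = altSum f (suc j) m
    E = f (suc (j ℕ.+ m))
    lower : W j - E ≤ f j - r
    lower = begin
      W j - E                          ≡⟨ solve 3 (λ w u e → w :- e := (w :+ u) :- (u :+ e)) refl (W j) (U (suc j)) E ⟩
      (W j + U (suc j)) - (U (suc j) + E) ≤⟨ ℚP.+-monoˡ-≤ _ (W+U≤f j) ⟩
      f j - (U (suc j) + E)            ≤⟨ ℚP.+-monoʳ-≤ (f j) (ℚP.neg-antimono-≤ r≤U+E) ⟩
      f j - r                          ∎
      where open ℚP.≤-Reasoning
    upper : f j - r ≤ U j + E
    upper = begin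
      f j - r                          ≤⟨ ℚP.+-monoʳ-≤ (f j) (ℚP.neg-antimono-≤ W-E≤r) ⟩
      f j - (W (suc j) - E)            ≡⟨ solve 3 (λ x w e → x :- (w :- e) := (x :+ e) :- w) refl (f j) (W (suc j)) E ⟩
      (f j + E) - W (suc j)            ≤⟨ ℚP.+-monoˡ-≤ _ (ℚP.+-monoˡ-≤ E (f≤U+W j)) ⟩
      (U j + W (suc j) + E) - W (suc j) ≡⟨ solve 3 (λ u w e → (u :+ w :+ e) :- w := u :+ e) refl (U j) (W (suc j)) E ⟩
      U j + E                          ∎
      where open ℚP.≤-Reasoning

limitInvFloor-intro : ∀ {s f} δ ε → Positive δ → Positive ε → Cauchy s →
  (∃ λ N → ∀ m → m ≥ N → δ ≤ ∣ s m ∣ × toℚ f ≤ inv (s m) × inv (s m) ≤ toℚ f + 1ℚ - ε) →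
  LimitInvFloor s f
limitInvFloor-intro {s} {f} δ ε δ>0 ε>0 s-cauchy (N , bounds) =
  s-cauchy ,
  (δ , δ>0 , N , λ m m≥N → proj₁ (bounds m m≥N)) ,
  (λ ε′ ε′>0 → N , λ m m≥N → ℚP.<-≤-trans (p-q<p (toℚ f) ε′ ε′>0) (proj₁ (proj₂ (bounds m m≥N)))) ,
  (ε , ε>0 , N , λ m m≥N → proj₂ (proj₂ (bounds m m≥N)))

cauchy-*-unit : ∀ {s t} u → ∣ u ∣ ≡ 1ℚ → (∀ m → t m ≡ u * s m) → Cauchy s → Cauchy t
cauchy-*-unit {s} {t} u ∣u∣≡1 t≡us s-cauchy ε ε>0 with s-cauchy ε ε>0
... | N , close = N , λ i j i≥N j≥N → subst (_< ε) (sym (∣t-t∣≡∣s-s∣ i j)) (close i j i≥N j≥N)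
  where
  ∣t-t∣≡∣s-s∣ : ∀ i j → ∣ t i - t j ∣ ≡ ∣ s i - s j ∣
  ∣t-t∣≡∣s-s∣ i j = begin
    ∣ t i - t j ∣              ≡⟨ cong₂ (λ x y → ∣ x - y ∣) (t≡us i) (t≡us j) ⟩
    ∣ u * s i - u * s j ∣      ≡⟨ cong ∣_∣ (solve 3 (λ u x y → u :* x :- u :* y := u :* (x :- y)) refl u (s i) (s j)) ⟩
    ∣ u * (s i - s j) ∣        ≡⟨ ℚP.∣p*q∣≡∣p∣*∣q∣ u (s i - s j) ⟩
    ∣ u ∣ * ∣ s i - s j ∣      ≡⟨ cong (_* ∣ s i - s j ∣) ∣u∣≡1 ⟩
    1ℚ * ∣ s i - s j ∣         ≡⟨ ℚP.*-identityˡ _ ⟩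
    ∣ s i - s j ∣              ∎
    where open ≡-Reasoning

inv-suc-< : ∀ ε → Positive ε → ∃ λ N → inv (toℚ (+ suc N)) < ε
inv-suc-< ε@(mkℚ +[1+ p ] d _) _ = suc d , subst (_< ε) (sym (cong inv (toℚ≡mkℚ (+ suc (suc d)))))
  (*<* (subst₂ ℤ._<_ (ℤP.pos-* 1 (suc d)) (ℤP.pos-* (suc p) (suc (suc d)))
     (+<+ (ℕP.<-≤-trans (subst (ℕ._< suc (suc d)) (sym (ℕP.*-identityˡ (suc d))) ℕP.≤-refl)
                        (ℕP.m≤n*m (suc (suc d)) (suc p))))))

-- Indices are shifted by one (ρ k = 1/B_{k+1}², and c k below is c_{k+1}),
-- so that every denominator is positive.
ρ : ℕ → ℚ
ρ k = inv (toℚ (B (suc k) ℤ.* B (suc k)))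

tailPartial≡alt*altSum : ∀ k N → tailPartial (suc k) N ≡ alt (suc k) * altSum ρ k N
tailPartial≡alt*altSum k zero = refl
tailPartial≡alt*altSum k (suc N) rewrite tailPartial≡alt*altSum k N | altSum-snoc ρ k N | alt-+ (suc k) (suc N) =
  solve 4 (λ a r s x → a :* r :+ a :* s :* x := a :* (r :+ s :* x)) refl
    (alt (suc k)) (altSum ρ k N) (alt (suc N)) (ρ (k ℕ.+ suc N))

ρ≡1⁄B² : ∀ k → ρ k ≡ + 1 ⁄ (B (suc k) ℤ.* B (suc k))
ρ≡1⁄B² k = sym (1⁄b≡inv (B (suc k) ℤ.* B (suc k)))

ρ-nonNeg : ∀ k → 0ℚ ≤ ρ k
ρ-nonNeg k = ℚP.<⇒≤ (inv-pos _ (toℚ-mono-< (B²-pos k)))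

ρ-antitone : ∀ k → ρ (suc k) ≤ ρ k
ρ-antitone k = inv-antimono-≤ _ _ (toℚ-mono-< (B²-pos k))
  (toℚ-mono-≤ (square-mono (B-nonNeg (suc k)) (B-≤-suc (suc k))))

ρ-vanishes : Vanishes ρ
ρ-vanishes ε ε>0 with inv-suc-< ε ε>0
... | N , 1⁄N+1<ε = N , ℚP.≤-<-trans
  (inv-antimono-≤ (toℚ (+ suc N)) _ (toℚ-mono-< {+ 0} {+ suc N} 0<+suc) (toℚ-mono-≤ (B²-≥ N))) 1⁄N+1<ε

module _ (x y : ℤ) (cassini : x ℤ.* x ℤ.- + 6 ℤ.* x ℤ.* y ℤ.+ y ℤ.* y ≡ + 1)
         (0≤y : + 0 ℤ.≤ y) (y<x : y ℤ.+ + 1 ℤ.≤ x) where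

  private
    c₀ c₁ : ℤ
    c₀ = x ℤ.* x ℤ.+ y ℤ.* y
    c₁ = (+ 6 ℤ.* x ℤ.- y) ℤ.* (+ 6 ℤ.* x ℤ.- y) ℤ.+ x ℤ.* x

    y≤x : y ℤ.≤ x
    y≤x = ℤP.≤-trans (ℤP.i≤i+j y (+ 1)) y<x

    0≤x : + 0 ℤ.≤ x
    0≤x = ℤP.≤-trans 0≤y y≤x

    0<x² : + 0 ℤ.< x ℤ.* x
    0<x² = *-pos 0<x 0<x
      where 0<x = ℤP.<-≤-trans (+suc-pos 0 0≤y) y<x

    0≤c₀ : + 0 ℤ.≤ c₀
    0≤c₀ = +-nonNeg (*-nonNeg 0≤x 0≤x) (*-nonNeg 0≤y 0≤y)

    0≤c₁ : + 0 ℤ.≤ c₁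
    0≤c₁ = +-nonNeg (*-nonNeg 0≤6x-y 0≤6x-y) (*-nonNeg 0≤x 0≤x)
      where
      0≤6x-y : + 0 ℤ.≤ + 6 ℤ.* x ℤ.- y
      0≤6x-y = ℤP.i≤j⇒0≤j-i (ℤP.≤-trans y≤x (subst (ℤ._≤ + 6 ℤ.* x) (ℤP.*-identityˡ x)
                 (ℤP.*-monoʳ-≤-nonNeg x {{ℤ.nonNegative 0≤x}} {+ 1} {+ 6} (+≤+ (ℕ.s≤s ℕ.z≤n)))))

  -- Both inequalities are proved with denominators cleared; each certificate is
  -- a multiple of the relation x² − 6xy + y² − 1 = 0 plus a manifestly
  -- nonnegative term.
  1⁄x²≤upper+next-lower : + 5 ℤ.* y ℤ.≤ x →
    + 1 ⁄ (x ℤ.* x) ≤ + 100 ⁄ (+ 100 ℤ.* c₀ ℤ.+ + 1) + + 2 ⁄ (+ 2 ℤ.* c₁ ℤ.+ + 1)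
  1⁄x²≤upper+next-lower 5y≤x = begin
    + 1 ⁄ (x ℤ.* x)                        ≤⟨ ⁄-mono-≤ 0<x² (*-pos 0<u 0<w) (+ 1) (+ 100 ℤ.* w ℤ.+ + 2 ℤ.* u) cleared ⟩
    (+ 100 ℤ.* w ℤ.+ + 2 ℤ.* u) ⁄ (u ℤ.* w) ≡⟨ sym (⁄-+ 0<u 0<w (+ 100) (+ 2)) ⟩
    + 100 ⁄ u + + 2 ⁄ w                    ∎
    where
    open ℚP.≤-Reasoning
    u = + 100 ℤ.* c₀ ℤ.+ + 1
    w = + 2 ℤ.* c₁ ℤ.+ + 1
    0<u = *+suc-pos 100 0 0≤c₀
    0<w = *+suc-pos 2 0 0≤c₁
    0≤x-1 : + 0 ℤ.≤ x ℤ.- + 1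
    0≤x-1 = ℤP.i≤j⇒0≤j-i (ℤP.≤-trans (ℤP.+-monoˡ-≤ (+ 1) 0≤y) y<x)
    cleared : + 1 ℤ.* (u ℤ.* w) ℤ.≤ (+ 100 ℤ.* w ℤ.+ + 2 ℤ.* u) ℤ.* (x ℤ.* x)
    cleared = ℤP.*-cancelˡ-≤-pos _ _ (+ 5)
      (≤-by-certificate _ _
        (ℤ.- (+ 1510) ℤ.- (+ 1000 ℤ.* y ℤ.* y) ℤ.+ (+ 6000 ℤ.* x ℤ.* y) ℤ.+ (+ 1000 ℤ.* x ℤ.* x)) _
        (+ 1515 ℤ.* ((x ℤ.- + 1) ℤ.* (x ℤ.+ + 1)) ℤ.+ + 47 ℤ.* (x ℤ.* x) ℤ.+ + 588 ℤ.* (x ℤ.* (x ℤ.- + 5 ℤ.* y)))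
        (identity x y) (cong (ℤ._- + 1) cassini)
        (+-nonNeg (+-nonNeg (*-nonNeg (0≤+ 1515) (*-nonNeg 0≤x-1 (+-nonNeg 0≤x (0≤+ 1))))
                            (*-nonNeg (0≤+ 47) (*-nonNeg 0≤x 0≤x)))
                  (*-nonNeg (0≤+ 588) (*-nonNeg 0≤x (ℤP.i≤j⇒0≤j-i 5y≤x)))))
      where
      identity : ∀ x y → + 5 ℤ.* ((+ 100 ℤ.* (+ 2 ℤ.* ((+ 6 ℤ.* x ℤ.- y) ℤ.* (+ 6 ℤ.* x ℤ.- y) ℤ.+ x ℤ.* x) ℤ.+ + 1) ℤ.+ + 2 ℤ.* (+ 100 ℤ.* (x ℤ.* x ℤ.+ y ℤ.* y) ℤ.+ + 1)) ℤ.* (x ℤ.* x))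
          ℤ.- + 5 ℤ.* (+ 1 ℤ.* ((+ 100 ℤ.* (x ℤ.* x ℤ.+ y ℤ.* y) ℤ.+ + 1) ℤ.* (+ 2 ℤ.* ((+ 6 ℤ.* x ℤ.- y) ℤ.* (+ 6 ℤ.* x ℤ.- y) ℤ.+ x ℤ.* x) ℤ.+ + 1)))
        ≡ (ℤ.- (+ 1510) ℤ.- (+ 1000 ℤ.* y ℤ.* y) ℤ.+ (+ 6000 ℤ.* x ℤ.* y) ℤ.+ (+ 1000 ℤ.* x ℤ.* x)) ℤ.* (x ℤ.* x ℤ.- + 6 ℤ.* x ℤ.* y ℤ.+ y ℤ.* y ℤ.- + 1)
          ℤ.+ (+ 1515 ℤ.* ((x ℤ.- + 1) ℤ.* (x ℤ.+ + 1)) ℤ.+ + 47 ℤ.* (x ℤ.* x) ℤ.+ + 588 ℤ.* (x ℤ.* (x ℤ.- + 5 ℤ.* y)))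
      identity = solve-∀

  lower+next-upper≤1⁄x² : + 2 ⁄ (+ 2 ℤ.* c₀ ℤ.+ + 1) + + 100 ⁄ (+ 100 ℤ.* c₁ ℤ.+ + 1) ≤ + 1 ⁄ (x ℤ.* x)
  lower+next-upper≤1⁄x² = begin
    + 2 ⁄ w + + 100 ⁄ u                    ≡⟨ ⁄-+ 0<w 0<u (+ 2) (+ 100) ⟩
    (+ 2 ℤ.* u ℤ.+ + 100 ℤ.* w) ⁄ (w ℤ.* u) ≤⟨ ⁄-mono-≤ (*-pos 0<w 0<u) 0<x² (+ 2 ℤ.* u ℤ.+ + 100 ℤ.* w) (+ 1) cleared ⟩
    + 1 ⁄ (x ℤ.* x)                        ∎
    where
    open ℚP.≤-Reasoning
    w = + 2 ℤ.* c₀ ℤ.+ + 1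
    u = + 100 ℤ.* c₁ ℤ.+ + 1
    0<w = *+suc-pos 2 0 0≤c₀
    0<u = *+suc-pos 100 0 0≤c₁
    cleared : (+ 2 ℤ.* u ℤ.+ + 100 ℤ.* w) ℤ.* (x ℤ.* x) ℤ.≤ + 1 ℤ.* (w ℤ.* u)
    cleared = ≤-by-certificate _ _
      ((+ 302) ℤ.+ (+ 200 ℤ.* y ℤ.* y) ℤ.- (+ 1200 ℤ.* x ℤ.* y) ℤ.- (+ 200 ℤ.* x ℤ.* x)) _
      (+ 2510 ℤ.* (x ℤ.* x) ℤ.+ + 588 ℤ.* (x ℤ.* (x ℤ.- y)) ℤ.+ + 303)
      (identity x y) (cong (ℤ._- + 1) cassini)
      (+-nonNeg (+-nonNeg (*-nonNeg (0≤+ 2510) (*-nonNeg 0≤x 0≤x))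
                          (*-nonNeg (0≤+ 588) (*-nonNeg 0≤x (ℤP.i≤j⇒0≤j-i y≤x))))
                (0≤+ 303))
      where
      identity : ∀ x y → + 1 ℤ.* ((+ 2 ℤ.* (x ℤ.* x ℤ.+ y ℤ.* y) ℤ.+ + 1) ℤ.* (+ 100 ℤ.* ((+ 6 ℤ.* x ℤ.- y) ℤ.* (+ 6 ℤ.* x ℤ.- y) ℤ.+ x ℤ.* x) ℤ.+ + 1))
          ℤ.- (+ 2 ℤ.* (+ 100 ℤ.* ((+ 6 ℤ.* x ℤ.- y) ℤ.* (+ 6 ℤ.* x ℤ.- y) ℤ.+ x ℤ.* x) ℤ.+ + 1) ℤ.+ + 100 ℤ.* (+ 2 ℤ.* (x ℤ.* x ℤ.+ y ℤ.* y) ℤ.+ + 1)) ℤ.* (x ℤ.* x)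
        ≡ ((+ 302) ℤ.+ (+ 200 ℤ.* y ℤ.* y) ℤ.- (+ 1200 ℤ.* x ℤ.* y) ℤ.- (+ 200 ℤ.* x ℤ.* x)) ℤ.* (x ℤ.* x ℤ.- + 6 ℤ.* x ℤ.* y ℤ.+ y ℤ.* y ℤ.- + 1)
          ℤ.+ (+ 2510 ℤ.* (x ℤ.* x) ℤ.+ + 588 ℤ.* (x ℤ.* (x ℤ.- y)) ℤ.+ + 303)
      identity = solve-∀

c : ℕ → ℤ
c k = B (suc k) ℤ.* B (suc k) ℤ.+ B k ℤ.* B k

c-nonNeg : ∀ k → + 0 ℤ.≤ c k
c-nonNeg k = +-nonNeg (*-nonNeg (B-nonNeg (suc k)) (B-nonNeg (suc k))) (*-nonNeg (B-nonNeg k) (B-nonNeg k))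

upper lower : ℕ → ℚ
upper k = + 100 ⁄ (+ 100 ℤ.* c k ℤ.+ + 1)
lower k = + 2 ⁄ (+ 2 ℤ.* c k ℤ.+ + 1)

upper-nonNeg : ∀ k → 0ℚ ≤ upper k
upper-nonNeg k = ℚP.<⇒≤ (⁄-pos {+ 100} 0<+suc (*+suc-pos 100 0 (c-nonNeg k)))

ρ≤upper+lower : ∀ k → ρ k ≤ upper k + lower (suc k)
ρ≤upper+lower k = subst (_≤ upper k + lower (suc k)) (sym (ρ≡1⁄B² k))
  (1⁄x²≤upper+next-lower (B (suc k)) (B k) (B-cassini k) (B-nonNeg k) (B-increasing k) (B-5× k))

lower+upper≤ρ : ∀ k → lower k + upper (suc k) ≤ ρ k
lower+upper≤ρ k = subst (lower k + upper (suc k) ≤_) (sym (ρ≡1⁄B² k))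
  (lower+next-upper≤1⁄x² (B (suc k)) (B k) (B-cassini k) (B-nonNeg k) (B-increasing k))

tail-envelope : ∀ k m → lower k - ρ (k ℕ.+ m) ≤ altSum ρ k m × altSum ρ k m ≤ upper k + ρ (k ℕ.+ m)
tail-envelope = altSum-envelope {ρ} {upper} {lower} ρ-nonNeg upper-nonNeg ρ≤upper+lower lower+upper≤ρ

-- A partial sum differs from the tail by at most its last term; once that is
-- below 1 / slack a, the tail bounds 1/(a + 1/100) and 1/(a + 1/2) degrade
-- no further than 1/(a + 1/200) and 1/(a + 3/4).
slack : ℤ → ℤ
slack a = (+ 100 ℤ.* a ℤ.+ + 1) ℤ.* (a ℤ.* + 200 ℤ.+ + 1)

module _ (a : ℤ) (0≤a : + 0 ℤ.≤ a) where

  private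
    0<100*a+1 : + 0 ℤ.< + 100 ℤ.* a ℤ.+ + 1
    0<100*a+1 = *+suc-pos 100 0 0≤a

    0<2*a+1 : + 0 ℤ.< + 2 ℤ.* a ℤ.+ + 1
    0<2*a+1 = *+suc-pos 2 0 0≤a

  0<a*200+1 : + 0 ℤ.< a ℤ.* + 200 ℤ.+ + 1
  0<a*200+1 = +suc-pos 0 (*-nonNeg 0≤a (0≤+ 200))

  0<a*4+3 : + 0 ℤ.< a ℤ.* + 4 ℤ.+ + 3
  0<a*4+3 = +suc-pos 2 (*-nonNeg 0≤a (0≤+ 4))

  0<slack : + 0 ℤ.< slack a
  0<slack = *-pos 0<100*a+1 0<a*200+1

  upper+slack≤ : + 100 ⁄ (+ 100 ℤ.* a ℤ.+ + 1) + + 1 ⁄ slack a ≤ + 200 ⁄ (a ℤ.* + 200 ℤ.+ + 1)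
  upper+slack≤ = begin
    + 100 ⁄ (+ 100 ℤ.* a ℤ.+ + 1) + + 1 ⁄ slack a
      ≡⟨ ⁄-+ 0<100*a+1 0<slack (+ 100) (+ 1) ⟩
    (+ 100 ℤ.* slack a ℤ.+ + 1 ℤ.* (+ 100 ℤ.* a ℤ.+ + 1)) ⁄ ((+ 100 ℤ.* a ℤ.+ + 1) ℤ.* slack a)
      ≤⟨ ⁄-mono-≤ (*-pos 0<100*a+1 0<slack) 0<a*200+1 (+ 100 ℤ.* slack a ℤ.+ + 1 ℤ.* (+ 100 ℤ.* a ℤ.+ + 1)) (+ 200)
           (≤-by-difference _ _ _ (identity a) (*-nonNeg (0≤+ 99) (ℤP.<⇒≤ 0<slack))) ⟩
    + 200 ⁄ (a ℤ.* + 200 ℤ.+ + 1) ∎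
    where
    open ℚP.≤-Reasoning
    identity : ∀ a → + 200 ℤ.* ((+ 100 ℤ.* a ℤ.+ + 1) ℤ.* ((+ 100 ℤ.* a ℤ.+ + 1) ℤ.* (a ℤ.* + 200 ℤ.+ + 1)))
        ℤ.- (+ 100 ℤ.* ((+ 100 ℤ.* a ℤ.+ + 1) ℤ.* (a ℤ.* + 200 ℤ.+ + 1)) ℤ.+ + 1 ℤ.* (+ 100 ℤ.* a ℤ.+ + 1)) ℤ.* (a ℤ.* + 200 ℤ.+ + 1)
      ≡ + 99 ℤ.* ((+ 100 ℤ.* a ℤ.+ + 1) ℤ.* (a ℤ.* + 200 ℤ.+ + 1))
    identity = solve-∀

  ≤lower-slack : + 1 ℤ.≤ a → + 4 ⁄ (a ℤ.* + 4 ℤ.+ + 3) ≤ + 2 ⁄ (+ 2 ℤ.* a ℤ.+ + 1) - + 1 ⁄ slack a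
  ≤lower-slack 1≤a = begin
    + 4 ⁄ (a ℤ.* + 4 ℤ.+ + 3)
      ≤⟨ ⁄-mono-≤ 0<a*4+3 (*-pos 0<2*a+1 0<slack) (+ 4) (+ 2 ℤ.* slack a ℤ.- + 1 ℤ.* (+ 2 ℤ.* a ℤ.+ + 1))
           (≤-by-difference _ _ _ (identity a)
             (+-nonNeg (+-nonNeg (*-nonNeg (0≤+ 39992) (*-nonNeg 0≤a 0≤a)) (*-nonNeg (0≤+ 589) 0≤a))
                       (ℤP.i≤j⇒0≤j-i 1≤a))) ⟩
    (+ 2 ℤ.* slack a ℤ.- + 1 ℤ.* (+ 2 ℤ.* a ℤ.+ + 1)) ⁄ ((+ 2 ℤ.* a ℤ.+ + 1) ℤ.* slack a)
      ≡⟨ sym (⁄-- 0<2*a+1 0<slack (+ 2) (+ 1)) ⟩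
    + 2 ⁄ (+ 2 ℤ.* a ℤ.+ + 1) - + 1 ⁄ slack a ∎
    where
    open ℚP.≤-Reasoning
    identity : ∀ a → (+ 2 ℤ.* ((+ 100 ℤ.* a ℤ.+ + 1) ℤ.* (a ℤ.* + 200 ℤ.+ + 1)) ℤ.- + 1 ℤ.* (+ 2 ℤ.* a ℤ.+ + 1)) ℤ.* (a ℤ.* + 4 ℤ.+ + 3)
        ℤ.- + 4 ℤ.* ((+ 2 ℤ.* a ℤ.+ + 1) ℤ.* ((+ 100 ℤ.* a ℤ.+ + 1) ℤ.* (a ℤ.* + 200 ℤ.+ + 1)))
      ≡ + 39992 ℤ.* (a ℤ.* a) ℤ.+ + 589 ℤ.* a ℤ.+ (a ℤ.- + 1)
    identity = solve-∀

module Tail (k : ℕ) where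

  a : ℤ
  a = c k

  R s : ℕ → ℚ
  R = altSum ρ k
  s = tailPartial (suc k)

  lo : ℚ
  lo = + 4 ⁄ (a ℤ.* + 4 ℤ.+ + 3)

  0≤a : + 0 ℤ.≤ a
  0≤a = c-nonNeg k

  1≤a : + 1 ℤ.≤ a
  1≤a = ℤP.≤-trans (ℤP.≤-trans (+≤+ (ℕ.s≤s ℕ.z≤n)) (B²-≥ k))
          (ℤP.i≤i+j _ (B k ℤ.* B k) {{ℤ.nonNegative (*-nonNeg (B-nonNeg k) (B-nonNeg k))}})

  0<lo : 0ℚ < lo
  0<lo = ⁄-pos {+ 4} 0<+suc (0<a*4+3 a 0≤a)

  hi : ℚ
  hi = + 200 ⁄ (a ℤ.* + 200 ℤ.+ + 1)

  private
    ρ-small : ∃ λ N → ∀ n → N ℕ.≤ n → ρ n < + 1 ⁄ slack a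
    ρ-small = eventually-< ρ-nonNeg ρ-antitone ρ-vanishes (+ 1 ⁄ slack a)
                (ℚ.positive (⁄-pos {+ 1} {slack a} 0<+suc (0<slack a 0≤a)))

    N₀ : ℕ
    N₀ = proj₁ ρ-small

    ρ≤1⁄slack : ∀ m → m ≥ N₀ → ρ (k ℕ.+ m) ≤ + 1 ⁄ slack a
    ρ≤1⁄slack m m≥N₀ = ℚP.<⇒≤ (proj₂ ρ-small (k ℕ.+ m) (ℕP.≤-trans m≥N₀ (ℕP.m≤n+m m k)))

  lo≤R : ∀ m → m ≥ N₀ → lo ≤ R m
  lo≤R m m≥N₀ = begin
    lo                            ≤⟨ ≤lower-slack a 0≤a 1≤a ⟩
    lower k - + 1 ⁄ slack a       ≤⟨ ℚP.+-monoʳ-≤ (lower k) (ℚP.neg-antimono-≤ (ρ≤1⁄slack m m≥N₀)) ⟩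
    lower k - ρ (k ℕ.+ m)         ≤⟨ proj₁ (tail-envelope k m) ⟩
    R m                           ∎
    where open ℚP.≤-Reasoning

  R≤hi : ∀ m → m ≥ N₀ → R m ≤ hi
  R≤hi m m≥N₀ = begin
    R m                           ≤⟨ proj₂ (tail-envelope k m) ⟩
    upper k + ρ (k ℕ.+ m)         ≤⟨ ℚP.+-monoʳ-≤ (upper k) (ρ≤1⁄slack m m≥N₀) ⟩
    upper k + + 1 ⁄ slack a       ≤⟨ upper+slack≤ a 0≤a ⟩
    hi                            ∎
    where open ℚP.≤-Reasoning

  0<R : ∀ m → m ≥ N₀ → 0ℚ < R m
  0<R m m≥N₀ = ℚP.<-≤-trans 0<lo (lo≤R m m≥N₀)

  a+1⁄200≤inv-R : ∀ m → m ≥ N₀ → toℚ a + + 1 ⁄ + 200 ≤ inv (R m)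
  a+1⁄200≤inv-R m m≥N₀ = begin
    toℚ a + + 1 ⁄ + 200                 ≡⟨ toℚ-+-⁄ a (+ 1) {+ 200} 0<+suc ⟩
    (a ℤ.* + 200 ℤ.+ + 1) ⁄ + 200       ≡⟨ sym (inv-⁄ {+ 200} 0<+suc (0<a*200+1 a 0≤a)) ⟩
    inv hi                              ≤⟨ inv-antimono-≤ (R m) hi (0<R m m≥N₀) (R≤hi m m≥N₀) ⟩
    inv (R m)                           ∎
    where open ℚP.≤-Reasoning

  inv-R≤a+3⁄4 : ∀ m → m ≥ N₀ → inv (R m) ≤ toℚ a + + 3 ⁄ + 4
  inv-R≤a+3⁄4 m m≥N₀ = begin
    inv (R m)                           ≤⟨ inv-antimono-≤ lo (R m) 0<lo (lo≤R m m≥N₀) ⟩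
    inv lo                              ≡⟨ inv-⁄ {+ 4} 0<+suc (0<a*4+3 a 0≤a) ⟩
    (a ℤ.* + 4 ℤ.+ + 3) ⁄ + 4           ≡⟨ sym (toℚ-+-⁄ a (+ 3) {+ 4} 0<+suc) ⟩
    toℚ a + + 3 ⁄ + 4                   ∎
    where open ℚP.≤-Reasoning

  s-cauchy : Cauchy s
  s-cauchy = cauchy-*-unit (alt (suc k)) (∣alt∣≡1 (suc k)) (tailPartial≡alt*altSum k)
               (altSum-cauchy ρ-nonNeg ρ-antitone ρ-vanishes k)

  lo≤∣s∣ : ∀ m → m ≥ N₀ → lo ≤ ∣ s m ∣
  lo≤∣s∣ m m≥N₀ = subst (lo ≤_) (sym ∣s∣≡R) (lo≤R m m≥N₀)
    where
    ∣s∣≡R : ∣ s m ∣ ≡ R m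
    ∣s∣≡R = begin
      ∣ s m ∣                      ≡⟨ cong ∣_∣ (tailPartial≡alt*altSum k m) ⟩
      ∣ alt (suc k) * R m ∣        ≡⟨ ℚP.∣p*q∣≡∣p∣*∣q∣ (alt (suc k)) (R m) ⟩
      ∣ alt (suc k) ∣ * ∣ R m ∣    ≡⟨ cong₂ _*_ (∣alt∣≡1 (suc k)) (ℚP.0≤p⇒∣p∣≡p (ℚP.<⇒≤ (0<R m m≥N₀))) ⟩
      1ℚ * R m                     ≡⟨ ℚP.*-identityˡ (R m) ⟩
      R m                          ∎
      where open ≡-Reasoning

  floor-even : alt (suc k) ≡ 1ℚ → LimitInvFloor s a
  floor-even alt≡1 = limitInvFloor-intro {f = a} lo (+ 1 ⁄ + 4) (ℚ.positive 0<lo) (ℚ.positive 0<1⁄4) s-cauchy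
    (N₀ , λ m m≥N₀ → lo≤∣s∣ m m≥N₀ , a≤inv-s m m≥N₀ , inv-s≤ m m≥N₀)
    where
    inv-s≡inv-R : ∀ m → inv (s m) ≡ inv (R m)
    inv-s≡inv-R m = cong inv (trans (tailPartial≡alt*altSum k m) (trans (cong (_* R m) alt≡1) (ℚP.*-identityˡ (R m))))
    a≤inv-s : ∀ m → m ≥ N₀ → toℚ a ≤ inv (s m)
    a≤inv-s m m≥N₀ = begin
      toℚ a                        ≤⟨ q≤q+p (toℚ a) (ℚP.<⇒≤ 0<1⁄200) ⟩
      toℚ a + + 1 ⁄ + 200          ≤⟨ a+1⁄200≤inv-R m m≥N₀ ⟩
      inv (R m)                    ≡⟨ sym (inv-s≡inv-R m) ⟩
      inv (s m)                    ∎
      where open ℚP.≤-Reasoning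
    inv-s≤ : ∀ m → m ≥ N₀ → inv (s m) ≤ toℚ a + 1ℚ - + 1 ⁄ + 4
    inv-s≤ m m≥N₀ = begin
      inv (s m)                    ≡⟨ inv-s≡inv-R m ⟩
      inv (R m)                    ≤⟨ inv-R≤a+3⁄4 m m≥N₀ ⟩
      toℚ a + + 3 ⁄ + 4            ≡⟨ cong (λ x → toℚ a + x) 3⁄4≡1-1⁄4 ⟩
      toℚ a + (1ℚ - + 1 ⁄ + 4)     ≡⟨ sym (ℚP.+-assoc (toℚ a) 1ℚ (- (+ 1 ⁄ + 4))) ⟩
      toℚ a + 1ℚ - + 1 ⁄ + 4       ∎
      where open ℚP.≤-Reasoning

  floor-odd : alt (suc k) ≡ - 1ℚ → LimitInvFloor s (ℤ.- (a ℤ.+ + 1))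
  floor-odd alt≡-1 = limitInvFloor-intro {f = ℤ.- (a ℤ.+ + 1)} lo (+ 1 ⁄ + 200) (ℚ.positive 0<lo) (ℚ.positive 0<1⁄200) s-cauchy
    (N₀ , λ m m≥N₀ → lo≤∣s∣ m m≥N₀ , f≤inv-s m m≥N₀ , inv-s≤ m m≥N₀)
    where
    f≡-[a+1] : toℚ (ℤ.- (a ℤ.+ + 1)) ≡ - (toℚ a + 1ℚ)
    f≡-[a+1] = trans (toℚ-neg (a ℤ.+ + 1)) (cong -_ (toℚ-+ a (+ 1)))
    inv-s≡-inv-R : ∀ m → m ≥ N₀ → inv (s m) ≡ - inv (R m)
    inv-s≡-inv-R m m≥N₀ = trans (cong inv s≡-R) (inv-neg (R m) (0<R m m≥N₀))
      where
      s≡-R : s m ≡ - R m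
      s≡-R = trans (tailPartial≡alt*altSum k m)
               (trans (cong (_* R m) alt≡-1) (trans (sym (ℚP.neg-distribˡ-* 1ℚ (R m))) (cong -_ (ℚP.*-identityˡ (R m)))))
    f≤inv-s : ∀ m → m ≥ N₀ → toℚ (ℤ.- (a ℤ.+ + 1)) ≤ inv (s m)
    f≤inv-s m m≥N₀ = begin
      toℚ (ℤ.- (a ℤ.+ + 1))        ≡⟨ f≡-[a+1] ⟩
      - (toℚ a + 1ℚ)               ≤⟨ ℚP.neg-antimono-≤ (begin
        inv (R m)                    ≤⟨ inv-R≤a+3⁄4 m m≥N₀ ⟩
        toℚ a + + 3 ⁄ + 4            ≡⟨ cong (λ x → toℚ a + x) 3⁄4≡1-1⁄4 ⟩
        toℚ a + (1ℚ - + 1 ⁄ + 4)     ≤⟨ ℚP.+-monoʳ-≤ (toℚ a) (0≤p⇒q-p≤q 1ℚ (ℚP.<⇒≤ 0<1⁄4)) ⟩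
        toℚ a + 1ℚ                   ∎) ⟩
      - inv (R m)                  ≡⟨ sym (inv-s≡-inv-R m m≥N₀) ⟩
      inv (s m)                    ∎
      where open ℚP.≤-Reasoning
    inv-s≤ : ∀ m → m ≥ N₀ → inv (s m) ≤ toℚ (ℤ.- (a ℤ.+ + 1)) + 1ℚ - + 1 ⁄ + 200
    inv-s≤ m m≥N₀ = begin
      inv (s m)                    ≡⟨ inv-s≡-inv-R m m≥N₀ ⟩
      - inv (R m)                  ≤⟨ ℚP.neg-antimono-≤ (a+1⁄200≤inv-R m m≥N₀) ⟩
      - (toℚ a + + 1 ⁄ + 200)      ≡⟨ solve 2 (λ x e → :- (x :+ e) := :- (x :+ con 1ℚ) :+ con 1ℚ :- e) refl (toℚ a) (+ 1 ⁄ + 200) ⟩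
      - (toℚ a + 1ℚ) + 1ℚ - + 1 ⁄ + 200 ≡⟨ cong (λ x → x + 1ℚ - + 1 ⁄ + 200) (sym f≡-[a+1]) ⟩
      toℚ (ℤ.- (a ℤ.+ + 1)) + 1ℚ - + 1 ⁄ + 200 ∎
      where open ℚP.≤-Reasoning

alt-parity : ∀ n → (2 ∣ n × alt n ≡ 1ℚ) ⊎ (2 ∣ suc n × alt n ≡ - 1ℚ)
alt-parity zero = inj₁ (divides 0 refl , refl)
alt-parity (suc n) with alt-parity n
... | inj₁ (2∣n , alt≡1) = inj₂ (∣m∣n⇒∣m+n {2} {2} {n} ∣-refl 2∣n , cong -_ alt≡1)
... | inj₂ (2∣1+n , alt≡-1) = inj₁ (2∣1+n , cong -_ alt≡-1)

alt-even : ∀ {n} → 2 ∣ n → alt n ≡ 1ℚ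
alt-even {n} 2∣n with alt-parity n
... | inj₁ (_ , alt≡1) = alt≡1
... | inj₂ (2∣1+n , _) with ∣1⇒≡1 (∣m+n∣m⇒∣n {2} {n} {1} (subst (2 ∣_) (ℕP.+-comm 1 n) 2∣1+n) 2∣n)
...   | ()

alt-odd : ∀ {n} → ¬ 2 ∣ n → alt n ≡ - 1ℚ
alt-odd {n} 2∤n with alt-parity n
... | inj₁ (2∣n , _) = ⊥-elim (2∤n 2∣n)
... | inj₂ (_ , alt≡-1) = alt≡-1

theorem6 : ∀ (n : ℕ) → n ≥ 1 →
    (2 ∣ n → LimitInvFloor (tailPartial n) (B n ℤ.* B n ℤ.+ B (n ∸ 1) ℤ.* B (n ∸ 1))) ×
    (¬ (2 ∣ n) → LimitInvFloor (tailPartial n) (ℤ.- (B n ℤ.* B n ℤ.+ B (n ∸ 1) ℤ.* B (n ∸ 1) ℤ.+ + 1)))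
theorem6 (suc k) _ = (λ 2∣n → Tail.floor-even k (alt-even 2∣n)) , (λ 2∤n → Tail.floor-odd k (alt-odd 2∤n))
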